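{- Let $G$ be a connected word-representable graph on $n=|V(G)|$ vertices with representation number $k\ge 3$, and let $w$ be a $k$-uniform word representing $G$, with first three permutations $P_1,P_2,P_3$. Let $c=c_1c_2c_3\cdots$ be the infinite ternary word defined below, let $h$ be the morphism with $h(2)=P_1$, $h(1)=P_2$, $h(0)=P_3$, and let $w'=h(c)=h(c_1)h(c_2)h(c_3)\cdots$. Then for every positive integer $i$, the word $w\,w'[n\cdot i]$ represents $G$, where $w'[m]$ denotes the prefix of $w'$ of length $m$ (so $w'[n\cdot i]=h(c_1)\cdots h(c_i)$).
   Context: A word $w$ over the alphabet $V$ represents the simple graph $G=(V,E)$ if every letter of $V$ occurs in $w$ and, for all distinct $x,y\in V$, $x$ and $y$ alternate in $w$ (deleting all other letters leaves $xyxy\cdots$ or $yxyx\cdots$) if and only if $xy\in E$. A word is $k$-uniform if every letter occurs exactly $k$ times; the representation number of $G$ is the least $k$ such that some $k$-uniform word represents $G$. For a $k$-uniform word $w$, the $i$-th permutation $P_i$ is obtained from $w$ by deleting, for each letter, all but its $i$-th occurrence. Thue–Morse sequence: $t=t_0t_1t_2\cdots$ where $t_m=0$ if the binary expansion of $m$ has an even number of $1$'s and $t_m=1$ otherwise, so $t=0110100110010110\cdots$. For $n\ge1$, $c_n$ is the number of $1$'s between the $n$-th and $(n+1)$-th occurrences of $0$ in $t$; thus $c=210201\cdots$, an infinite square-free word over $\{0,1,2\}$. -}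

module Defs where

open import Data.Nat using (ℕ; zero; suc; _+_; _*_; _∸_; _<_; _≤_; _≡ᵇ_; _<ᵇ_)
open import Data.Nat.DivMod using (_%_; _/_)
open import Data.Fin as Fin using (Fin)
open import Data.Bool using (Bool; true; false; if_then_else_; _∨_; _∧_; not)
open import Data.List using (List; []; _∷_; _++_; filterᵇ; length; upTo; concatMap; map)
open import Data.List.Membership.Propositional using (_∈_)
open import Relation.Nullary using (¬_; does)
open import Relation.Binary.PropositionalEquality using (_≡_; _≢_)
open import Data.Product using (Σ; ∃; _×_; _,_)
open import Function.Bundles using (_⇔_)

record SimpleGraph (n : ℕ) : Set where
  field
    adj    : Fin n → Fin n → Bool
    sym    : ∀ x y → adj x y ≡ adj y x
    irrefl : ∀ x → adj x x ≡ false
open SimpleGraph public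

data Reach {n : ℕ} (G : SimpleGraph n) : Fin n → Fin n → Set where
  here : ∀ {x} → Reach G x x
  step : ∀ {x y z} → adj G x y ≡ true → Reach G y z → Reach G x z

Connected : {n : ℕ} → SimpleGraph n → Set
Connected {n} G = (0 < n) × (∀ x y → Reach G x y)

Word : ℕ → Set
Word n = List (Fin n)

_==_ : {n : ℕ} → Fin n → Fin n → Bool
x == y = does (x Fin.≟ y)

count : {n : ℕ} → Fin n → Word n → ℕ
count x []       = 0
count x (y ∷ ys) = if x == y then suc (count x ys) else count x ys

restrict : {n : ℕ} → Fin n → Fin n → Word n → Word n
restrict x y = filterᵇ (λ z → (z == x) ∨ (z == y))

noAdjRepeat : {n : ℕ} → Word n → Bool
noAdjRepeat []           = true
noAdjRepeat (x ∷ [])     = true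
noAdjRepeat (x ∷ y ∷ r)  = not (x == y) ∧ noAdjRepeat (y ∷ r)

-- x and y alternate in w: deleting all other letters leaves
-- xyxy... or yxyx... (a word over {x,y} without factor xx or yy)
Alternate : {n : ℕ} → Word n → Fin n → Fin n → Set
Alternate w x y = noAdjRepeat (restrict x y w) ≡ true

Represents : {n : ℕ} → SimpleGraph n → Word n → Set
Represents G w =
  (∀ x → x ∈ w) ×
  (∀ x y → x ≢ y → (Alternate w x y ⇔ (adj G x y ≡ true)))

Uniform : {n : ℕ} → ℕ → Word n → Set
Uniform k w = ∀ x → count x w ≡ k

KRepresentable : {n : ℕ} → SimpleGraph n → ℕ → Set
KRepresentable G k = Σ (Word _) λ w → Uniform k w × Represents G w

RepresentationNumber : {n : ℕ} → SimpleGraph n → ℕ → Set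
RepresentationNumber G k =
  KRepresentable G k × (∀ k′ → k′ < k → ¬ KRepresentable G k′)

-- i-th permutation (i ≥ 1): keep, for each letter, only its i-th occurrence
permAux : {n : ℕ} → ℕ → (Fin n → ℕ) → Word n → Word n
permAux i cnt [] = []
permAux i cnt (x ∷ xs) =
  let cnt′ = λ z → if z == x then suc (cnt z) else cnt z
      rest = permAux i cnt′ xs
  in if suc (cnt x) ≡ᵇ i then x ∷ rest else rest

perm : {n : ℕ} → ℕ → Word n → Word n
perm i w = permAux i (λ _ → 0) w

-- sum of binary digits of m, with fuel (fuel ≥ m suffices)
bitSum : ℕ → ℕ → ℕ
bitSum zero      m = 0
bitSum (suc f)   m = m % 2 + bitSum f (m / 2)

thueMorse : ℕ → ℕ
thueMorse m = bitSum m m % 2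

zerosBelow : ℕ → List ℕ
zerosBelow L = filterᵇ (λ p → thueMorse p ≡ᵇ 0) (upTo L)

-- j-th element (0-indexed) of a list, default 0
nth : List ℕ → ℕ → ℕ
nth []       _       = 0
nth (x ∷ xs) zero    = x
nth (x ∷ xs) (suc j) = nth xs j

-- c_n (n ≥ 1): number of 1's in t strictly between the n-th and the
-- (n+1)-th occurrence of 0.  Since t_{2m} ≠ t_{2m+1}, the j-th zero
-- (1-indexed) lies at a position < 2j, so the window 2(n+1) suffices.
cSeq : ℕ → ℕ
cSeq n =
  let L = 2 * suc n
      p = nth (zerosBelow L) (n ∸ 1)
      q = nth (zerosBelow L) n
  in length (filterᵇ (λ m → (p <ᵇ m) ∧ (m <ᵇ q) ∧ (thueMorse m ≡ᵇ 1)) (upTo L))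

-- the morphism h: 2 ↦ P₁, 1 ↦ P₂, 0 ↦ P₃ (other letters never occur in c)
hMorph : {n : ℕ} → Word n → ℕ → Word n
hMorph w 0 = perm 3 w
hMorph w 1 = perm 2 w
hMorph w 2 = perm 1 w
hMorph w _ = []

-- w'[n·i] = h(c_1) h(c_2) ... h(c_i)
wPrimePrefix : {n : ℕ} → Word n → ℕ → Word n
wPrimePrefix w i = concatMap (λ j → hMorph w (cSeq j)) (map suc (upTo i))

-- If x and y are adjacent, w restricted to {x, y} has no repeated letter and, w being
-- uniform, contains x and y equally often, so it is (xy)^k or (yx)^k.  Extracting the
-- j-th permutation commutes with this restriction and turns (xy)^k into xy, so each block
-- h(c_m) of w′ restricted to {x, y} is xy (resp. yx), and w w′[n·i] still alternates on
-- x, y.  Non-adjacent x, y already fail to alternate in the prefix w.  So appending any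
-- concatenation of permutations of w preserves the represented graph.
module Submission where

open import Defs hiding (sym)
open import Data.Nat using (ℕ; suc; _≤_; _≡ᵇ_)
open import Data.Nat.Properties using (suc-injective)
open import Data.List using ([]; _∷_; _++_; filterᵇ; concatMap; map; upTo)
open import Data.List.Properties using (filter-++)
open import Data.List.Relation.Unary.All as All using (All; []; _∷_)
open import Data.List.Relation.Unary.All.Properties using (all-filter)
open import Data.List.Membership.Propositional.Properties using (∈-++⁺ˡ)
open import Data.Fin as Fin using (Fin)
open import Data.Bool using (Bool; true; false; if_then_else_; _∨_; _∧_; T; T?)
open import Data.Bool.Properties using (T-≡; T-∨; ∨-zeroʳ; ∧-conicalˡ; ∧-conicalʳ)
open import Data.Product using (_,_)
open import Data.Sum as Sum using (_⊎_; inj₁; inj₂)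
open import Data.Empty using (⊥-elim)
open import Function using (_∘_; case_of_)
open import Function.Bundles using (mk⇔; Equivalence)
open import Relation.Nullary using (yes; no)
open import Relation.Nullary.Decidable using (dec-true; dec-false)
open import Relation.Binary.PropositionalEquality

module _ {n : ℕ} where

  ==-refl : (x : Fin n) → (x == x) ≡ true
  ==-refl x = dec-true (x Fin.≟ x) refl

  ==-≢ : {x y : Fin n} → x ≢ y → (x == y) ≡ false
  ==-≢ {x} {y} = dec-false (x Fin.≟ y)

  ==⇒≡ : {x y : Fin n} → (x == y) ≡ true → x ≡ y
  ==⇒≡ {x} {y} e with x Fin.≟ y | e
  ... | yes x≡y | _ = x≡y
  ... | no _    | ()

  count-filterᵇ : (p : Fin n → Bool) {x : Fin n} → p x ≡ true →
                  ∀ w → count x (filterᵇ p w) ≡ count x w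
  count-filterᵇ p px [] = refl
  count-filterᵇ p {x} px (z ∷ w) with p z in pz
  ... | true with x == z
  ...   | true  = cong suc (count-filterᵇ p px w)
  ...   | false = count-filterᵇ p px w
  count-filterᵇ p {x} px (z ∷ w) | false with x == z in xz
  ...   | false = count-filterᵇ p px w
  ...   | true  = case trans (sym px) (trans (cong p (==⇒≡ xz)) pz) of λ ()

  count-∷-≡ : (x : Fin n) (r : Word n) → count x (x ∷ r) ≡ suc (count x r)
  count-∷-≡ x r rewrite ==-refl x = refl

  count-∷-≢ : {x z : Fin n} (r : Word n) → x ≢ z → count x (z ∷ r) ≡ count x r
  count-∷-≢ r x≢z rewrite ==-≢ x≢z = refl

  count-restrictˡ : (x y : Fin n) (w : Word n) → count x (restrict x y w) ≡ count x w
  count-restrictˡ x y = count-filterᵇ _ (cong (_∨ (x == y)) (==-refl x))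

  count-restrictʳ : (x y : Fin n) (w : Word n) → count y (restrict x y w) ≡ count y w
  count-restrictʳ x y =
    count-filterᵇ _ (trans (cong ((y == x) ∨_) (==-refl y)) (∨-zeroʳ (y == x)))

  restrict-++ : (x y : Fin n) (u v : Word n) →
                restrict x y (u ++ v) ≡ restrict x y u ++ restrict x y v
  restrict-++ x y = filter-++ (T? ∘ λ z → (z == x) ∨ (z == y))

  OneOf : Fin n → Fin n → Fin n → Set
  OneOf a b z = z ≡ a ⊎ z ≡ b

  All-OneOf-restrict : (x y : Fin n) (w : Word n) → All (OneOf x y) (restrict x y w)
  All-OneOf-restrict x y w =
    All.map (Sum.map ==⇒T≡ ==⇒T≡ ∘ Equivalence.to T-∨)
            (all-filter (T? ∘ λ z → (z == x) ∨ (z == y)) w)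
    where ==⇒T≡ : {z u : Fin n} → T (z == u) → z ≡ u
          ==⇒T≡ = ==⇒≡ ∘ Equivalence.to T-≡

  noAdjRepeat-∷⁻ : (x : Fin n) (r : Word n) →
                   noAdjRepeat (x ∷ r) ≡ true → noAdjRepeat r ≡ true
  noAdjRepeat-∷⁻ x []      _ = refl
  noAdjRepeat-∷⁻ x (y ∷ r) e = ∧-conicalʳ _ _ e

  noAdjRepeat-∷ : {x y : Fin n} (r : Word n) → x ≢ y →
                  noAdjRepeat (y ∷ r) ≡ true → noAdjRepeat (x ∷ y ∷ r) ≡ true
  noAdjRepeat-∷ r x≢y e rewrite ==-≢ x≢y = e

  noAdjRepeat-square : (x : Fin n) (r : Word n) → noAdjRepeat (x ∷ x ∷ r) ≢ true
  noAdjRepeat-square x r e rewrite ==-refl x = case e of λ ()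

  noAdjRepeat-++⁻ˡ : (u v : Word n) → noAdjRepeat (u ++ v) ≡ true → noAdjRepeat u ≡ true
  noAdjRepeat-++⁻ˡ []          v e = refl
  noAdjRepeat-++⁻ˡ (x ∷ [])    v e = refl
  noAdjRepeat-++⁻ˡ (x ∷ y ∷ u) v e =
    cong₂ _∧_ (∧-conicalˡ _ _ e) (noAdjRepeat-++⁻ˡ (y ∷ u) v (∧-conicalʳ _ _ e))

  data Alternating (a b : Fin n) : Word n → Set where
    []   : Alternating a b []
    ab∷_ : {r : Word n} → Alternating a b r → Alternating a b (a ∷ b ∷ r)

  Alternating-++ : {a b : Fin n} {u v : Word n} →
                   Alternating a b u → Alternating a b v → Alternating a b (u ++ v)
  Alternating-++ []       q = q
  Alternating-++ (ab∷ p) q = ab∷ Alternating-++ p q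

  Alternating⇒noAdjRepeat : {a b : Fin n} {r : Word n} → a ≢ b →
                            Alternating a b r → noAdjRepeat r ≡ true
  Alternating⇒noAdjRepeat {a} {b} a≢b []           = refl
  Alternating⇒noAdjRepeat {a} {b} a≢b (ab∷_ {r} p) = noAdjRepeat-∷ r a≢b (after-b p)
    where
    after-b : ∀ {r} → Alternating a b r → noAdjRepeat (b ∷ r) ≡ true
    after-b []           = refl
    after-b (ab∷_ {r} p) =
      noAdjRepeat-∷ (b ∷ r) (≢-sym a≢b) (noAdjRepeat-∷ r a≢b (after-b p))

  balanced⇒Alternating-after : {a b : Fin n} {r : Word n} → a ≢ b → All (OneOf a b) r →
    noAdjRepeat (b ∷ r) ≡ true → count a r ≡ count b r → Alternating a b r
  balanced⇒Alternating-after a≢b [] _ _ = []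
  balanced⇒Alternating-after {a} {b} a≢b (inj₁ refl ∷ []) _ c =
    case trans (sym (count-∷-≡ a [])) (trans c (count-∷-≢ [] (≢-sym a≢b))) of λ ()
  balanced⇒Alternating-after {a} {b} {_ ∷ _ ∷ r} a≢b (inj₁ refl ∷ inj₁ refl ∷ o) nr _ =
    ⊥-elim (noAdjRepeat-square a r (noAdjRepeat-∷⁻ b (a ∷ a ∷ r) nr))
  balanced⇒Alternating-after {b = b} {_ ∷ r} a≢b (inj₂ refl ∷ o) nr _ =
    ⊥-elim (noAdjRepeat-square b r nr)
  balanced⇒Alternating-after {a} {b} {_ ∷ _ ∷ r} a≢b (inj₁ refl ∷ inj₂ refl ∷ o) nr c =
    ab∷ balanced⇒Alternating-after a≢b o
          (noAdjRepeat-∷⁻ a (b ∷ r) (noAdjRepeat-∷⁻ b (a ∷ b ∷ r) nr))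
          (suc-injective (begin
            suc (count a r)        ≡⟨ cong suc (sym (count-∷-≢ r a≢b)) ⟩
            suc (count a (b ∷ r))  ≡⟨ sym (count-∷-≡ a (b ∷ r)) ⟩
            count a (a ∷ b ∷ r)    ≡⟨ c ⟩
            count b (a ∷ b ∷ r)    ≡⟨ count-∷-≢ (b ∷ r) (≢-sym a≢b) ⟩
            count b (b ∷ r)        ≡⟨ count-∷-≡ b r ⟩
            suc (count b r)        ∎))
    where open ≡-Reasoning

  balanced⇒Alternating : {a b : Fin n} {r : Word n} → a ≢ b → All (OneOf a b) r →
    noAdjRepeat r ≡ true → count a r ≡ count b r → Alternating a b r ⊎ Alternating b a r
  balanced⇒Alternating a≢b [] _ _ = inj₁ []
  balanced⇒Alternating {r = _ ∷ r} a≢b o@(inj₁ refl ∷ _) nr c =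
    inj₁ (balanced⇒Alternating-after a≢b o (noAdjRepeat-∷ r (≢-sym a≢b) nr) c)
  balanced⇒Alternating {r = _ ∷ r} a≢b o@(inj₂ refl ∷ _) nr c =
    inj₂ (balanced⇒Alternating-after (≢-sym a≢b) (All.map Sum.swap o)
            (noAdjRepeat-∷ r a≢b nr) (sym c))

  bump : (Fin n → ℕ) → Fin n → Fin n → ℕ
  bump cnt x z = if z == x then suc (cnt z) else cnt z

  AgreeOn : (Fin n → Bool) → (Fin n → ℕ) → (Fin n → ℕ) → Set
  AgreeOn p cnt cnt′ = ∀ z → p z ≡ true → cnt z ≡ cnt′ z

  bump-agree : {p : Fin n → Bool} {cnt cnt′ : Fin n → ℕ} (x : Fin n) →
               AgreeOn p cnt cnt′ → AgreeOn p (bump cnt x) (bump cnt′ x)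
  bump-agree x e z pz with z == x
  ... | true  = cong suc (e z pz)
  ... | false = e z pz

  bump-agree-reject : {p : Fin n → Bool} {cnt cnt′ : Fin n → ℕ} {x : Fin n} →
                      p x ≡ false → AgreeOn p cnt cnt′ → AgreeOn p (bump cnt x) cnt′
  bump-agree-reject {p} {x = x} px e z pz with z == x in zx
  ... | false = e z pz
  ... | true  = case trans (sym pz) (trans (cong p (==⇒≡ zx)) px) of λ ()

  permAux-filterᵇ : (p : Fin n → Bool) (i : ℕ) {cnt cnt′ : Fin n → ℕ} →
    AgreeOn p cnt cnt′ → (w : Word n) →
    filterᵇ p (permAux i cnt w) ≡ permAux i cnt′ (filterᵇ p w)
  permAux-filterᵇ p i e [] = refl
  permAux-filterᵇ p i {cnt} {cnt′} e (x ∷ w) with p x in px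
  ... | true rewrite e x px with suc (cnt′ x) ≡ᵇ i
  ...   | true rewrite px = cong (x ∷_) (permAux-filterᵇ p i (bump-agree x e) w)
  ...   | false           = permAux-filterᵇ p i (bump-agree x e) w
  permAux-filterᵇ p i {cnt} e (x ∷ w) | false with suc (cnt x) ≡ᵇ i
  ...   | true rewrite px = permAux-filterᵇ p i (bump-agree-reject px e) w
  ...   | false           = permAux-filterᵇ p i (bump-agree-reject px e) w

  perm-filterᵇ : (p : Fin n → Bool) (i : ℕ) (w : Word n) →
                 filterᵇ p (perm i w) ≡ perm i (filterᵇ p w)
  perm-filterᵇ p i = permAux-filterᵇ p i (λ _ _ → refl)

  bump²-balanced : {a b : Fin n} (cnt : Fin n → ℕ) → a ≢ b → cnt a ≡ cnt b →
                   bump (bump cnt a) b a ≡ bump (bump cnt a) b b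
  bump²-balanced {a} {b} cnt a≢b e
    rewrite ==-≢ a≢b | ==-refl a | ==-refl b | ==-≢ (≢-sym a≢b) = cong suc e

  -- a and b having been read equally often, the a and the b of each factor ab are
  -- kept or dropped together.
  permAux-Alternating : (j : ℕ) {a b : Fin n} {r : Word n} (cnt : Fin n → ℕ) → a ≢ b →
    cnt a ≡ cnt b → Alternating a b r → Alternating a b (permAux j cnt r)
  permAux-Alternating j cnt a≢b e [] = []
  permAux-Alternating j {a} {b} cnt a≢b e (ab∷ p)
    with permAux-Alternating j (bump (bump cnt a) b) a≢b (bump²-balanced cnt a≢b e) p
  ... | ih rewrite ==-≢ (≢-sym a≢b) | e with suc (cnt b) ≡ᵇ j
  ...   | true  = ab∷ ih
  ...   | false = ih

  FollowsAlternations : Word n → Word n → Set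
  FollowsAlternations w v = ∀ {x y a b} → a ≢ b →
    Alternating a b (restrict x y w) → Alternating a b (restrict x y v)

  FollowsAlternations-perm : (w : Word n) (j : ℕ) → FollowsAlternations w (perm j w)
  FollowsAlternations-perm w j {x} {y} {a} {b} a≢b p =
    subst (Alternating a b) (sym (perm-filterᵇ (λ z → (z == x) ∨ (z == y)) j w))
          (permAux-Alternating j (λ _ → 0) a≢b refl p)

  FollowsAlternations-hMorph : (w : Word n) (m : ℕ) → FollowsAlternations w (hMorph w m)
  FollowsAlternations-hMorph w 0                   = FollowsAlternations-perm w 3
  FollowsAlternations-hMorph w 1                   = FollowsAlternations-perm w 2
  FollowsAlternations-hMorph w 2                   = FollowsAlternations-perm w 1
  FollowsAlternations-hMorph w (suc (suc (suc _))) = λ _ _ → []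

  FollowsAlternations-concatMap : {A : Set} (w : Word n) (f : A → Word n) →
    (∀ m → FollowsAlternations w (f m)) → ∀ l → FollowsAlternations w (concatMap f l)
  FollowsAlternations-concatMap w f fol []      _   _ = []
  FollowsAlternations-concatMap w f fol (m ∷ l) {x} {y} a≢b p
    rewrite restrict-++ x y (f m) (concatMap f l) =
      Alternating-++ (fol m a≢b p) (FollowsAlternations-concatMap w f fol l a≢b p)

  FollowsAlternations-wPrimePrefix : (w : Word n) (i : ℕ) →
                                     FollowsAlternations w (wPrimePrefix w i)
  FollowsAlternations-wPrimePrefix w i =
    FollowsAlternations-concatMap w (hMorph w ∘ cSeq) (FollowsAlternations-hMorph w ∘ cSeq)
      (map suc (upTo i))

  Alternate-++⁻ˡ : (w v : Word n) (x y : Fin n) → Alternate (w ++ v) x y → Alternate w x y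
  Alternate-++⁻ˡ w v x y e =
    noAdjRepeat-++⁻ˡ (restrict x y w) (restrict x y v)
      (subst (λ r → noAdjRepeat r ≡ true) (restrict-++ x y w v) e)

  Uniform⇒restrict-balanced : {k : ℕ} (w : Word n) → Uniform k w → (x y : Fin n) →
    count x (restrict x y w) ≡ count y (restrict x y w)
  Uniform⇒restrict-balanced w uni x y = begin
    count x (restrict x y w)  ≡⟨ count-restrictˡ x y w ⟩
    count x w                 ≡⟨ trans (uni x) (sym (uni y)) ⟩
    count y w                 ≡⟨ sym (count-restrictʳ x y w) ⟩
    count y (restrict x y w)  ∎
    where open ≡-Reasoning

  Alternate-++ : {k : ℕ} (w : Word n) {v : Word n} → Uniform k w → FollowsAlternations w v →
    {x y : Fin n} → x ≢ y → Alternate w x y → Alternate (w ++ v) x y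
  Alternate-++ w {v} uni fol {x} {y} x≢y e
    rewrite restrict-++ x y w v
    with balanced⇒Alternating x≢y (All-OneOf-restrict x y w) e
                              (Uniform⇒restrict-balanced w uni x y)
  ... | inj₁ p = Alternating⇒noAdjRepeat x≢y (Alternating-++ p (fol x≢y p))
  ... | inj₂ p = Alternating⇒noAdjRepeat (≢-sym x≢y) (Alternating-++ p (fol (≢-sym x≢y) p))

  Represents-++ : {k : ℕ} {G : SimpleGraph n} (w : Word n) {v : Word n} → Uniform k w →
    FollowsAlternations w v → Represents G w → Represents G (w ++ v)
  Represents-++ w {v} uni fol (occurs , alt) =
    ∈-++⁺ˡ ∘ occurs ,
    λ x y x≢y → mk⇔ (Equivalence.to (alt x y x≢y) ∘ Alternate-++⁻ˡ w v x y)
                     (Alternate-++ w uni fol x≢y ∘ Equivalence.from (alt x y x≢y))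

mainTheorem12 : ∀ {n : ℕ} (G : SimpleGraph n) (k : ℕ) →
    Connected G → RepresentationNumber G k → 3 ≤ k →
    (w : Word n) → Uniform k w → Represents G w →
    ∀ (i : ℕ) → 1 ≤ i → Represents G (w ++ wPrimePrefix w i)
mainTheorem12 G k _ _ _ w uni rep i _ =
  Represents-++ {G = G} w uni (FollowsAlternations-wPrimePrefix w i) rep
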